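{- Let $M\in M_n(\mathbb Z)$ be symmetric. The duality pairing on $\mathrm{Hom}(\mathrm{tcok}(M),\mathbb Q/\mathbb Z)$ induced by $\langle\cdot,\cdot\rangle_M$ induces a duality pairing on $\mathrm{tcok}(M)$ (via the isomorphism $\rho:\mathrm{Hom}(\mathrm{tcok}(M),\mathbb Q/\mathbb Z)\to\mathrm{tcok}(M)$ it determines, by $\langle\tau,\tau'\rangle=\langle\rho^{ -1}\tau,\rho^{ -1}\tau'\rangle_M$), and this pairing on $\mathrm{tcok}(M)$ equals the Bosch–Lorenzini pairing $\langle\cdot,\cdot\rangle_{\mathrm{tcok}(M)}$.
   Context: $\mathrm{cok}(M)=\mathbb Z^n/M\mathbb Z^n$, $\mathrm{tcok}(M)=\ker(M)^\perp/M\mathbb Z^n$ its torsion subgroup. $\mathrm{Hom}(\mathrm{cok}(M),\mathbb Q/\mathbb Z)$ consists of $\phi:\mathbb Z^n\to\mathbb Q/\mathbb Z$ with $\phi M=0$, with symmetric pairing $\langle x,y\rangle_M=XMY^t\bmod\mathbb Z$ for row-vector lifts $X,Y\in\mathbb Q^n$. Its kernel is the annihilator of $\mathrm{tcok}(M)$, so it descends to a duality pairing on $\mathrm{Hom}(\mathrm{tcok}(M),\mathbb Q/\mathbb Z)$; since $\mathrm{tcok}(M)$ is finite, $\mathrm{Hom}(\mathrm{Hom}(\mathrm{tcok}(M),\mathbb Q/\mathbb Z),\mathbb Q/\mathbb Z)=\mathrm{tcok}(M)$. Bosch–Lorenzini pairing: for $\tau,\tau'\in\mathrm{tcok}(M)$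 choose lifts $T,T'\in\ker(M)^\perp$, $k,k'\in\mathbb N$ and $S,S'\in\mathbb Z^n$ with $MS=kT$, $MS'=k'T'$; then $\langle\tau,\tau'\rangle_{\mathrm{tcok}(M)}=S^tMS'/(kk')\bmod\mathbb Z$. -}

module Defs where

open import Data.Nat as ℕ using (ℕ; NonZero)
open import Data.Nat.Properties using (m*n≢0)
open import Data.Fin using (Fin; zero; suc)
open import Data.Integer as ℤ using (ℤ; 0ℤ)
open import Data.Rational as ℚ using (ℚ; _/_)
open import Data.Product using (Σ; _×_)
open import Relation.Binary.PropositionalEquality using (_≡_)

Vecℤ : ℕ → Set
Vecℤ n = Fin n → ℤ

Vecℚ : ℕ → Set
Vecℚ n = Fin n → ℚ

Mat : ℕ → Set
Mat n = Fin n → Fin n → ℤ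

Symmetric : ∀ {n} → Mat n → Set
Symmetric M = ∀ i j → M i j ≡ M j i

sumℤ : ∀ {n} → (Fin n → ℤ) → ℤ
sumℤ {ℕ.zero} f = 0ℤ
sumℤ {ℕ.suc n} f = f zero ℤ.+ sumℤ (λ i → f (suc i))

sumℚ : ∀ {n} → (Fin n → ℚ) → ℚ
sumℚ {ℕ.zero} f = ℚ.0ℚ
sumℚ {ℕ.suc n} f = f zero ℚ.+ sumℚ (λ i → f (suc i))

ι : ℤ → ℚ
ι z = z / 1

IsInt : ℚ → Set
IsInt q = Σ ℤ (λ z → q ≡ ι z)

_≡QZ_ : ℚ → ℚ → Set
p ≡QZ q = IsInt (p ℚ.- q)

dotℤ : ∀ {n} → Vecℤ n → Vecℤ n → ℤ
dotℤ v w = sumℤ (λ i → v i ℤ.* w i)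

mulVec : ∀ {n} → Mat n → Vecℤ n → Vecℤ n
mulVec M v i = sumℤ (λ j → M i j ℤ.* v j)

InKer : ∀ {n} → Mat n → Vecℤ n → Set
InKer M w = ∀ i → mulVec M w i ≡ 0ℤ

InKerPerp : ∀ {n} → Mat n → Vecℤ n → Set
InKerPerp M T = ∀ w → InKer M w → dotℤ T w ≡ 0ℤ

rowMul : ∀ {n} → Vecℚ n → Mat n → Vecℚ n
rowMul X M j = sumℚ (λ i → X i ℚ.* ι (M i j))

-- X ∈ ℚ^n is a lift of an element φ_X ∈ Hom(cok M, ℚ/ℤ), φ_X(v) = X·v mod ℤ,
-- i.e. φ_X ∘ M = 0, i.e. X M ∈ ℤ^n
IsHomLift : ∀ {n} → Mat n → Vecℚ n → Set
IsHomLift M X = ∀ j → IsInt (rowMul X M j)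

-- φ_X evaluated at an integer vector T (value in ℚ, to be read mod ℤ)
evalHom : ∀ {n} → Vecℚ n → Vecℤ n → ℚ
evalHom X T = sumℚ (λ i → X i ℚ.* ι (T i))

pairM : ∀ {n} → Mat n → Vecℚ n → Vecℚ n → ℚ
pairM M X Y = sumℚ (λ i → sumℚ (λ j → X i ℚ.* ι (M i j) ℚ.* Y j))

-- ρ(φ_X |tcok) = τ, where T ∈ ker(M)^⊥ lifts τ:  ρ is determined by the
-- duality pairing via  ψ'(ρ ψ) = ⟨ψ , ψ'⟩  for all ψ' ∈ Hom(tcok M, ℚ/ℤ);
-- every ψ' is the restriction of some φ_Y with Y a Hom-lift.
RhoRep : ∀ {n} → Mat n → Vecℚ n → Vecℤ n → Set
RhoRep M X T = ∀ Y → IsHomLift M Y → evalHom Y T ≡QZ pairM M X Y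

IsBLData : ∀ {n} → Mat n → Vecℤ n → (k : ℕ) → Vecℤ n → Set
IsBLData M T k S = ∀ i → mulVec M S i ≡ ℤ.+ k ℤ.* T i

blValue : ∀ {n} → Mat n → Vecℤ n → Vecℤ n → (k k' : ℕ) →
          .{{_ : NonZero k}} → .{{_ : NonZero k'}} → ℚ
blValue M S S' k k' = _/_ (dotℤ S (mulVec M S')) (k ℕ.* k') {{m*n≢0 k k'}}

-- Every T ∈ ker(M)^⊥ is X M for some X ∈ ℚ^n: by the Fredholm alternative, proved by
-- fraction-free Gaussian elimination, the only obstruction would be an integer w with w M = 0
-- and w·T ≠ 0, which T ⊥ ker(M) excludes. An exact lift X M = T represents ρ⁻¹(τ), because
-- ⟨X, Y⟩_M = φ_Y(T). For Bosch–Lorenzini data M S = k T the vector S/k is such an exact lift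
-- (M being symmetric), and M (S/k)ᵗ = T gives ⟨Y, S/k⟩_M = φ_Y(T). Hence modulo ℤ
--   ⟨ρ⁻¹τ, ρ⁻¹τ'⟩_M = φ_{X'}(T) = ⟨X', S/k⟩_M = φ_{S/k}(T') = ⟨S/k, S'/k'⟩_M = SᵗMS'/(kk').
module Submission where

open import Defs
open import Level using (0ℓ)
open import Function using (_∘_)
open import Data.Empty using (⊥-elim)
open import Data.Product using (Σ; ∃; _×_; _,_)
open import Data.Sum as Sum using (_⊎_; inj₁; inj₂)
open import Data.Nat as ℕ using (ℕ; zero; suc; NonZero)
import Data.Nat.Properties as ℕP
open import Data.Fin using (Fin; zero; suc)
import Data.Fin.Properties as FinP
open import Data.Vec.Functional using (_∷_)
open import Data.Integer as ℤ using (ℤ; 0ℤ; 1ℤ)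
import Data.Integer.Properties as ℤP
open import Data.Integer.Tactic.RingSolver using (solve-∀)
open import Data.Rational as ℚ using (ℚ; 0ℚ; 1ℚ; fromℚᵘ)
import Data.Rational.Properties as ℚP
open import Data.Rational.Solver using (module +-*-Solver)
open +-*-Solver using (solve; _:=_; _:+_; _:*_; :-_; _:-_)
open import Data.Rational.Unnormalised as ℚᵘ using (mkℚᵘ; *≡*)
import Data.Rational.Unnormalised.Properties as ℚᵘP
open import Algebra.Core using (Op₁; Op₂)
open import Algebra.Bundles using (CommutativeRing)
open import Algebra.Structures using (IsCommutativeRing)
import Algebra.Properties.Ring as RingProperties
import Algebra.Properties.Semiring.Sum as SemiringSum
open import Relation.Nullary using (yes; no)
open import Relation.Binary.Bundles using (Setoid)
open import Relation.Binary.Structures using (IsEquivalence)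
import Relation.Binary.Reasoning.Setoid as SetoidReasoning
open import Relation.Binary.PropositionalEquality

module FiniteSums
  {A : Set} {plus times : Op₂ A} {negate : Op₁ A} {0# 1# : A}
  (isCommutativeRing : IsCommutativeRing _≡_ plus times negate 0# 1#)
  (∑ : ∀ {n} → (Fin n → A) → A)
  (∑-[] : (f : Fin 0 → A) → ∑ f ≡ 0#)
  (∑-∷ : ∀ {n} (f : Fin (suc n) → A) → ∑ f ≡ plus (f zero) (∑ (f ∘ suc)))
  where

  private
    ring : CommutativeRing 0ℓ 0ℓ
    ring = record { isCommutativeRing = isCommutativeRing }
    open CommutativeRing ring using (_+_; _*_; -_)
    open RingProperties (CommutativeRing.ring ring) using (-‿distribˡ-*)
    module LibrarySum = SemiringSum (CommutativeRing.semiring ring)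

  ∑≡sum : ∀ {n} (f : Fin n → A) → ∑ f ≡ LibrarySum.sum f
  ∑≡sum {zero}  f = ∑-[] f
  ∑≡sum {suc n} f = trans (∑-∷ f) (cong (f zero +_) (∑≡sum (f ∘ suc)))

  ∑-cong : ∀ {n} {f g : Fin n → A} → (∀ i → f i ≡ g i) → ∑ f ≡ ∑ g
  ∑-cong {f = f} {g} f≗g = trans (∑≡sum f) (trans (LibrarySum.sum-cong-≗ f≗g) (sym (∑≡sum g)))

  ∑-zero : ∀ n → ∑ {n} (λ _ → 0#) ≡ 0#
  ∑-zero n = trans (∑≡sum _) (LibrarySum.sum-replicate-zero n)

  ∑-comm : ∀ {m n} (f : Fin m → Fin n → A) → ∑ (λ i → ∑ (f i)) ≡ ∑ (λ j → ∑ (λ i → f i j))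
  ∑-comm f = begin
    ∑ (λ i → ∑ (f i))                             ≡⟨ trans (∑-cong (λ i → ∑≡sum (f i))) (∑≡sum _) ⟩
    LibrarySum.sum (λ i → LibrarySum.sum (f i))   ≡⟨ LibrarySum.∑-comm f ⟩
    LibrarySum.sum (λ j → LibrarySum.sum (λ i → f i j))
                                                  ≡⟨ sym (trans (∑-cong (λ j → ∑≡sum _)) (∑≡sum _)) ⟩
    ∑ (λ j → ∑ (λ i → f i j))                     ∎
    where open ≡-Reasoning

  *-distribˡ-∑ : ∀ {n} a (f : Fin n → A) → a * ∑ f ≡ ∑ (λ i → a * f i)
  *-distribˡ-∑ a f =
    trans (cong (a *_) (∑≡sum f)) (trans (LibrarySum.*-distribˡ-sum a f) (sym (∑≡sum _)))

  *-distribʳ-∑ : ∀ {n} a (f : Fin n → A) → ∑ f * a ≡ ∑ (λ i → f i * a)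
  *-distribʳ-∑ a f =
    trans (cong (_* a) (∑≡sum f)) (trans (LibrarySum.*-distribʳ-sum a f) (sym (∑≡sum _)))

  ∑-distrib-+ : ∀ {n} (f g : Fin n → A) → ∑ (λ i → f i + g i) ≡ ∑ f + ∑ g
  ∑-distrib-+ f g =
    trans (∑≡sum _) (trans (LibrarySum.∑-distrib-+ f g) (sym (cong₂ _+_ (∑≡sum f) (∑≡sum g))))

  ∑-linear : ∀ {n} a b (f g : Fin n → A) →
             ∑ (λ i → a * f i + - (b * g i)) ≡ a * ∑ f + - (b * ∑ g)
  ∑-linear a b f g = begin
    ∑ (λ i → a * f i + - (b * g i))           ≡⟨ ∑-distrib-+ _ _ ⟩
    ∑ (λ i → a * f i) + ∑ (λ i → - (b * g i)) ≡⟨ cong (_+ ∑ (λ i → - (b * g i))) (sym (*-distribˡ-∑ a f)) ⟩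
    a * ∑ f + ∑ (λ i → - (b * g i))           ≡⟨ cong (a * ∑ f +_) (∑-cong (λ i → -‿distribˡ-* b (g i))) ⟩
    a * ∑ f + ∑ (λ i → - b * g i)             ≡⟨ cong (a * ∑ f +_) (sym (*-distribˡ-∑ (- b) g)) ⟩
    a * ∑ f + - b * ∑ g                       ≡⟨ cong (a * ∑ f +_) (sym (-‿distribˡ-* b (∑ g))) ⟩
    a * ∑ f + - (b * ∑ g)                     ∎
    where open ≡-Reasoning

module ∑ℤ = FiniteSums ℤP.+-*-isCommutativeRing sumℤ (λ _ → refl) (λ _ → refl)
module ∑ℚ = FiniteSums ℚP.+-*-isCommutativeRing sumℚ (λ _ → refl) (λ _ → refl)

-- ι z and z / suc d reduce to fromℚᵘ (mkℚᵘ z 0) and fromℚᵘ (mkℚᵘ z d), so their arithmetic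
-- is pulled back from ℚᵘ, where it holds up to ≃.
fromℚᵘ-homo-+ : ∀ p q → fromℚᵘ (p ℚᵘ.+ q) ≡ fromℚᵘ p ℚ.+ fromℚᵘ q
fromℚᵘ-homo-+ p q = ℚP.toℚᵘ-injective (ℚᵘP.≃-trans (ℚP.toℚᵘ-fromℚᵘ (p ℚᵘ.+ q))
  (ℚᵘP.≃-sym (ℚᵘP.≃-trans (ℚP.toℚᵘ-homo-+ (fromℚᵘ p) (fromℚᵘ q))
    (ℚᵘP.+-cong (ℚP.toℚᵘ-fromℚᵘ p) (ℚP.toℚᵘ-fromℚᵘ q)))))

fromℚᵘ-homo-* : ∀ p q → fromℚᵘ (p ℚᵘ.* q) ≡ fromℚᵘ p ℚ.* fromℚᵘ q
fromℚᵘ-homo-* p q = ℚP.toℚᵘ-injective (ℚᵘP.≃-trans (ℚP.toℚᵘ-fromℚᵘ (p ℚᵘ.* q))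
  (ℚᵘP.≃-sym (ℚᵘP.≃-trans (ℚP.toℚᵘ-homo-* (fromℚᵘ p) (fromℚᵘ q))
    (ℚᵘP.*-cong (ℚP.toℚᵘ-fromℚᵘ p) (ℚP.toℚᵘ-fromℚᵘ q)))))

fromℚᵘ-homo-neg : ∀ p → fromℚᵘ (ℚᵘ.- p) ≡ ℚ.- fromℚᵘ p
fromℚᵘ-homo-neg p = ℚP.toℚᵘ-injective (ℚᵘP.≃-trans (ℚP.toℚᵘ-fromℚᵘ (ℚᵘ.- p))
  (ℚᵘP.≃-sym (ℚᵘP.≃-trans (ℚP.toℚᵘ-homo‿- (fromℚᵘ p)) (ℚᵘP.-‿cong (ℚP.toℚᵘ-fromℚᵘ p)))))

ι-+ : ∀ a b → ι (a ℤ.+ b) ≡ ι a ℚ.+ ι b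
ι-+ a b = trans (ℚP.fromℚᵘ-cong {mkℚᵘ (a ℤ.+ b) 0} {mkℚᵘ a 0 ℚᵘ.+ mkℚᵘ b 0}
                                (*≡* (cong (ℤ._* 1ℤ) a+b≡a*1+b*1)))
                (fromℚᵘ-homo-+ (mkℚᵘ a 0) (mkℚᵘ b 0))
  where
  a+b≡a*1+b*1 : a ℤ.+ b ≡ a ℤ.* 1ℤ ℤ.+ b ℤ.* 1ℤ
  a+b≡a*1+b*1 = sym (cong₂ ℤ._+_ (ℤP.*-identityʳ a) (ℤP.*-identityʳ b))

ι-* : ∀ a b → ι (a ℤ.* b) ≡ ι a ℚ.* ι b
ι-* a b = trans (ℚP.fromℚᵘ-cong {mkℚᵘ (a ℤ.* b) 0} {mkℚᵘ a 0 ℚᵘ.* mkℚᵘ b 0} (*≡* refl))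
                (fromℚᵘ-homo-* (mkℚᵘ a 0) (mkℚᵘ b 0))

ι-neg : ∀ a → ι (ℤ.- a) ≡ ℚ.- ι a
ι-neg a = fromℚᵘ-homo-neg (mkℚᵘ a 0)

ι-injective : ∀ {a b} → ι a ≡ ι b → a ≡ b
ι-injective {a} {b} ιa≡ιb with ℚP.fromℚᵘ-injective {mkℚᵘ a 0} {mkℚᵘ b 0} ιa≡ιb
... | *≡* a*1≡b*1 = trans (sym (ℤP.*-identityʳ a)) (trans a*1≡b*1 (ℤP.*-identityʳ b))

ι-sum : ∀ {n} (f : Fin n → ℤ) → ι (sumℤ f) ≡ sumℚ (ι ∘ f)
ι-sum {zero}  f = refl
ι-sum {suc n} f = trans (ι-+ (f zero) (sumℤ (f ∘ suc))) (cong (ι (f zero) ℚ.+_) (ι-sum (f ∘ suc)))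

ι-dotℤ : ∀ {n} (v w : Vecℤ n) → ι (dotℤ v w) ≡ sumℚ (λ i → ι (v i) ℚ.* ι (w i))
ι-dotℤ v w = trans (ι-sum (λ i → v i ℤ.* w i)) (∑ℚ.∑-cong (λ i → ι-* (v i) (w i)))

ι-*-1/ : ∀ d .{{_ : NonZero d}} → ι (ℤ.+ d) ℚ.* (1ℤ ℚ./ d) ≡ 1ℚ
ι-*-1/ (suc d₀) = trans (sym (fromℚᵘ-homo-* (mkℚᵘ (ℤ.+ suc d₀) 0) (mkℚᵘ 1ℤ d₀)))
  (ℚP.fromℚᵘ-cong {mkℚᵘ (ℤ.+ suc d₀) 0 ℚᵘ.* mkℚᵘ 1ℤ d₀} {mkℚᵘ 1ℤ 0} (*≡* d*1*1≡1*[1*d]))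
  where
  d*1*1≡1*[1*d] : ℤ.+ suc d₀ ℤ.* 1ℤ ℤ.* 1ℤ ≡ 1ℤ ℤ.* ℤ.+ (1 ℕ.* suc d₀)
  d*1*1≡1*[1*d] = trans (ℤP.*-identityʳ _) (trans (ℤP.*-identityʳ _)
    (sym (trans (ℤP.*-identityˡ _) (cong ℤ.+_ (ℕP.*-identityˡ (suc d₀))))))

/-*-split : ∀ z d d' .{{_ : NonZero d}} .{{_ : NonZero d'}} →
            ℚ._/_ z (d ℕ.* d') {{ℕP.m*n≢0 d d'}} ≡ ι z ℚ.* ((1ℤ ℚ./ d) ℚ.* (1ℤ ℚ./ d'))
/-*-split z (suc d₀) (suc d₀') =
  trans (ℚP.fromℚᵘ-cong {mkℚᵘ z (d₀' ℕ.+ d₀ ℕ.* suc d₀')} {mkℚᵘ z 0 ℚᵘ.* (mkℚᵘ 1ℤ d₀ ℚᵘ.* mkℚᵘ 1ℤ d₀')}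
                        (*≡* z*[1*dd']≡z*1*dd'))
  (trans (fromℚᵘ-homo-* (mkℚᵘ z 0) _) (cong (ι z ℚ.*_) (fromℚᵘ-homo-* (mkℚᵘ 1ℤ d₀) (mkℚᵘ 1ℤ d₀'))))
  where
  dd' : ℕ
  dd' = suc d₀ ℕ.* suc d₀'
  z*[1*dd']≡z*1*dd' : z ℤ.* ℤ.+ (1 ℕ.* dd') ≡ z ℤ.* 1ℤ ℤ.* ℤ.+ dd'
  z*[1*dd']≡z*1*dd' =
    trans (cong (λ m → z ℤ.* ℤ.+ m) (ℕP.*-identityˡ dd')) (cong (ℤ._* ℤ.+ dd') (sym (ℤP.*-identityʳ z)))

≡QZ-isEquivalence : IsEquivalence _≡QZ_
≡QZ-isEquivalence = record
  { refl  = λ {p} → ≡QZ-refl {p}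
  ; sym   = λ {p} {q} → ≡QZ-sym {p} {q}
  ; trans = λ {p} {q} {r} → ≡QZ-trans {p} {q} {r}
  }
  where
  ≡QZ-refl : ∀ {p} → p ≡QZ p
  ≡QZ-refl {p} = 0ℤ , ℚP.+-inverseʳ p

  swap-difference : ∀ p q → q ℚ.- p ≡ ℚ.- (p ℚ.- q)
  swap-difference = solve 2 (λ p q → q :- p := :- (p :- q)) refl

  ≡QZ-sym : ∀ {p q} → p ≡QZ q → q ≡QZ p
  ≡QZ-sym {p} {q} (z , p-q≡z) =
    ℤ.- z , trans (swap-difference p q) (trans (cong ℚ.-_ p-q≡z) (sym (ι-neg z)))

  split-difference : ∀ p q r → p ℚ.- r ≡ (p ℚ.- q) ℚ.+ (q ℚ.- r)
  split-difference = solve 3 (λ p q r → p :- r := (p :- q) :+ (q :- r)) refl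

  ≡QZ-trans : ∀ {p q r} → p ≡QZ q → q ≡QZ r → p ≡QZ r
  ≡QZ-trans {p} {q} {r} (z , p-q≡z) (z' , q-r≡z') =
    z ℤ.+ z' , trans (split-difference p q r) (trans (cong₂ ℚ._+_ p-q≡z q-r≡z') (sym (ι-+ z z')))

ℚ/ℤ-setoid : Setoid 0ℓ 0ℓ
ℚ/ℤ-setoid = record { isEquivalence = ≡QZ-isEquivalence }

open Setoid ℚ/ℤ-setoid using () renaming (reflexive to ≡⇒≡QZ)

Matrix : ℕ → ℕ → Set
Matrix n m = Fin n → Fin m → ℤ

column : ∀ {n m} → Matrix n m → Fin m → Fin n → ℤ
column R i j = R j i

dropFirstColumn : ∀ {n m} → Matrix n (suc m) → Matrix n m
dropFirstColumn R j i = R j (suc i)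

mulVecℚ : ∀ {n m} → Matrix n m → (Fin m → ℚ) → Fin n → ℚ
mulVecℚ R x j = sumℚ (λ i → ι (R j i) ℚ.* x i)

RationalSolution : ∀ {n m} → Matrix n m → (Fin n → ℤ) → Set
RationalSolution {m = m} R b = Σ (Fin m → ℚ) λ x → ∀ j → mulVecℚ R x j ≡ ι (b j)

IntegralObstruction : ∀ {n m} → Matrix n m → (Fin n → ℤ) → Set
IntegralObstruction {n} R b =
  Σ (Fin n → ℤ) λ w → (∀ i → dotℤ w (column R i) ≡ 0ℤ) × dotℤ w b ≢ 0ℤ

basis : ∀ {n} → Fin n → Fin n → ℤ
basis zero    zero    = 1ℤ
basis zero    (suc j) = 0ℤ
basis (suc p) zero    = 0ℤ
basis (suc p) (suc j) = basis p j

dotℤ-basis : ∀ {n} (p : Fin n) (f : Fin n → ℤ) → dotℤ (basis p) f ≡ f p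
dotℤ-basis {suc n} zero f =
  trans (cong₂ ℤ._+_ (ℤP.*-identityˡ (f zero)) rest≡0) (ℤP.+-identityʳ (f zero))
  where
  rest≡0 : sumℤ (λ j → 0ℤ ℤ.* f (suc j)) ≡ 0ℤ
  rest≡0 = trans (∑ℤ.∑-cong (λ j → ℤP.*-zeroˡ (f (suc j)))) (∑ℤ.∑-zero n)
dotℤ-basis (suc p) f =
  trans (cong₂ ℤ._+_ (ℤP.*-zeroˡ (f zero)) (dotℤ-basis p (f ∘ suc))) (ℤP.+-identityˡ (f (suc p)))

zero-or-nonzero-entry : ∀ {n} (f : Fin n → ℤ) → (∀ j → f j ≡ 0ℤ) ⊎ ∃ λ j → f j ≢ 0ℤ
zero-or-nonzero-entry f with FinP.all? (λ j → f j ℤ.≟ 0ℤ)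
... | yes f≡0 = inj₁ f≡0
... | no  f≢0 = inj₂ (FinP.¬∀⟶∃¬ _ _ (λ j → f j ℤ.≟ 0ℤ) f≢0)

-- Fraction-free, so that an obstruction to the reduced system is pulled back by eliminateᵀ
-- to an integral one.
eliminate : ∀ {n} (r : Fin n → ℤ) (p : Fin n) → (Fin n → ℤ) → Fin n → ℤ
eliminate r p f j = r p ℤ.* f j ℤ.- r j ℤ.* f p

eliminateᵀ : ∀ {n} (r : Fin n → ℤ) (p : Fin n) → (Fin n → ℤ) → Fin n → ℤ
eliminateᵀ r p w j = r p ℤ.* w j ℤ.- dotℤ w r ℤ.* basis p j

module _ {n} (r : Fin n → ℤ) (p : Fin n) where

  dotℤ-eliminate : ∀ w f → dotℤ w (eliminate r p f) ≡ r p ℤ.* dotℤ w f ℤ.- f p ℤ.* dotℤ w r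
  dotℤ-eliminate w f =
    trans (∑ℤ.∑-cong (λ j → expand (w j) (r p) (f j) (r j) (f p)))
          (∑ℤ.∑-linear (r p) (f p) (λ j → w j ℤ.* f j) (λ j → w j ℤ.* r j))
    where
    expand : ∀ w c f r g → w ℤ.* (c ℤ.* f ℤ.- r ℤ.* g) ≡ c ℤ.* (w ℤ.* f) ℤ.- g ℤ.* (w ℤ.* r)
    expand = solve-∀

  dotℤ-eliminateᵀ : ∀ w f → dotℤ (eliminateᵀ r p w) f ≡ r p ℤ.* dotℤ w f ℤ.- dotℤ w r ℤ.* f p
  dotℤ-eliminateᵀ w f = begin
    dotℤ (eliminateᵀ r p w) f
      ≡⟨ ∑ℤ.∑-cong (λ j → expand (r p) (w j) (dotℤ w r) (basis p j) (f j)) ⟩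
    sumℤ (λ j → r p ℤ.* (w j ℤ.* f j) ℤ.- dotℤ w r ℤ.* (basis p j ℤ.* f j))
      ≡⟨ ∑ℤ.∑-linear (r p) (dotℤ w r) (λ j → w j ℤ.* f j) (λ j → basis p j ℤ.* f j) ⟩
    r p ℤ.* dotℤ w f ℤ.- dotℤ w r ℤ.* dotℤ (basis p) f
      ≡⟨ cong (λ t → r p ℤ.* dotℤ w f ℤ.- dotℤ w r ℤ.* t) (dotℤ-basis p f) ⟩
    r p ℤ.* dotℤ w f ℤ.- dotℤ w r ℤ.* f p ∎
    where
    open ≡-Reasoning
    expand : ∀ c w s e f → (c ℤ.* w ℤ.- s ℤ.* e) ℤ.* f ≡ c ℤ.* (w ℤ.* f) ℤ.- s ℤ.* (e ℤ.* f)
    expand = solve-∀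

  eliminate-adjoint : ∀ w f → dotℤ (eliminateᵀ r p w) f ≡ dotℤ w (eliminate r p f)
  eliminate-adjoint w f = trans (dotℤ-eliminateᵀ w f)
    (trans (cong (ℤ._-_ (r p ℤ.* dotℤ w f)) (ℤP.*-comm (dotℤ w r) (f p))) (sym (dotℤ-eliminate w f)))

  ι-eliminate : ∀ f j → ι (eliminate r p f j) ≡ ι (r p) ℚ.* ι (f j) ℚ.- ι (r j) ℚ.* ι (f p)
  ι-eliminate f j = trans (ι-+ (r p ℤ.* f j) (ℤ.- (r j ℤ.* f p)))
    (cong₂ ℚ._+_ (ι-* (r p) (f j)) (trans (ι-neg (r j ℤ.* f p)) (cong ℚ.-_ (ι-* (r j) (f p)))))

  mulVecℚ-eliminate : ∀ {m} (R : Matrix n m) x j →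
    mulVecℚ (λ j i → eliminate r p (column R i) j) x j
      ≡ ι (r p) ℚ.* mulVecℚ R x j ℚ.- ι (r j) ℚ.* mulVecℚ R x p
  mulVecℚ-eliminate R x j =
    trans (∑ℚ.∑-cong (λ i → trans (cong (ℚ._* x i) (ι-eliminate (column R i) j))
                                  (expand (ι (r p)) (ι (R j i)) (ι (r j)) (ι (R p i)) (x i))))
          (∑ℚ.∑-linear (ι (r p)) (ι (r j)) (λ i → ι (R j i) ℚ.* x i) (λ i → ι (R p i) ℚ.* x i))
    where
    expand : ∀ c a r g x → (c ℚ.* a ℚ.- r ℚ.* g) ℚ.* x ≡ c ℚ.* (a ℚ.* x) ℚ.- r ℚ.* (g ℚ.* x)
    expand = solve 5 (λ c a r g x → (c :* a :- r :* g) :* x := c :* (a :* x) :- r :* (g :* x)) refl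

back-substitution : ∀ c {u} → c ℚ.* u ≡ 1ℚ → ∀ r a aₚ b bₚ →
  c ℚ.* a ℚ.- r ℚ.* aₚ ≡ c ℚ.* b ℚ.- r ℚ.* bₚ → r ℚ.* ((bₚ ℚ.- aₚ) ℚ.* u) ℚ.+ a ≡ b
back-substitution c {u} cu≡1 r a aₚ b bₚ reduced = begin
  r * ((bₚ - aₚ) * u) + a                ≡⟨ cong (r * ((bₚ - aₚ) * u) +_) (sym (times-one a)) ⟩
  r * ((bₚ - aₚ) * u) + a * (c * u)      ≡⟨ regroup r a aₚ bₚ c u ⟩
  (c * a - r * aₚ) * u + r * bₚ * u      ≡⟨ cong (λ t → t * u + r * bₚ * u) reduced ⟩
  (c * b - r * bₚ) * u + r * bₚ * u      ≡⟨ cancel r b bₚ c u ⟩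
  b * (c * u)                            ≡⟨ times-one b ⟩
  b                                      ∎
  where
  open ≡-Reasoning
  open import Data.Rational using (_+_; _-_; _*_)
  times-one : ∀ x → x * (c * u) ≡ x
  times-one x = trans (cong (x *_) cu≡1) (ℚP.*-identityʳ x)
  regroup : ∀ r a aₚ bₚ c u → r * ((bₚ - aₚ) * u) + a * (c * u) ≡ (c * a - r * aₚ) * u + r * bₚ * u
  regroup = solve 6 (λ r a aₚ bₚ c u →
    r :* ((bₚ :- aₚ) :* u) :+ a :* (c :* u) := (c :* a :- r :* aₚ) :* u :+ r :* bₚ :* u) refl
  cancel : ∀ r b bₚ c u → (c * b - r * bₚ) * u + r * bₚ * u ≡ b * (c * u)
  cancel = solve 5 (λ r b bₚ c u → (c :* b :- r :* bₚ) :* u :+ r :* bₚ :* u := b :* (c :* u)) refl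

module ZeroColumn {n m} (R : Matrix n (suc m)) (b : Fin n → ℤ) (r≡0 : ∀ j → R j zero ≡ 0ℤ) where

  solution-step : RationalSolution (dropFirstColumn R) b → RationalSolution R b
  solution-step (x , solves) = 0ℚ ∷ x , λ j →
    trans (cong (ℚ._+ mulVecℚ (dropFirstColumn R) x j) (ℚP.*-zeroʳ (ι (R j zero))))
          (trans (ℚP.+-identityˡ _) (solves j))

  obstruction-step : IntegralObstruction (dropFirstColumn R) b → IntegralObstruction R b
  obstruction-step (w , w-annihilates , w·b≢0) = w , annihilates , w·b≢0
    where
    annihilates : ∀ i → dotℤ w (column R i) ≡ 0ℤ
    annihilates zero = trans (∑ℤ.∑-cong (λ j → trans (cong (w j ℤ.*_) (r≡0 j)) (ℤP.*-zeroʳ (w j))))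
                             (∑ℤ.∑-zero n)
    annihilates (suc i) = w-annihilates i

module Pivot {n m} (R : Matrix n (suc m)) (b : Fin n → ℤ) (p : Fin n) (rₚ≢0 : R p zero ≢ 0ℤ) where

  r : Fin n → ℤ
  r = column R zero

  reducedMatrix : Matrix n m
  reducedMatrix j i = eliminate r p (column (dropFirstColumn R) i) j

  reducedRhs : Fin n → ℤ
  reducedRhs = eliminate r p b

  solution-step : RationalSolution reducedMatrix reducedRhs → RationalSolution R b
  solution-step (x , solves-reduced) = x₀ ∷ x , solves
    where
    instance
      ι-rₚ-nonZero : ℚ.NonZero (ι (r p))
      ι-rₚ-nonZero = ℚ.≢-nonZero (λ ι-rₚ≡0 → rₚ≢0 (ι-injective ι-rₚ≡0))
    A : Fin n → ℚ
    A = mulVecℚ (dropFirstColumn R) x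
    x₀ : ℚ
    x₀ = (ι (b p) ℚ.- A p) ℚ.* ℚ.1/ ι (r p)
    solves : ∀ j → ι (r j) ℚ.* x₀ ℚ.+ A j ≡ ι (b j)
    solves j = back-substitution (ι (r p)) (ℚP.*-inverseʳ (ι (r p))) (ι (r j)) (A j) (A p) (ι (b j)) (ι (b p))
      (trans (sym (mulVecℚ-eliminate r p (dropFirstColumn R) x j))
             (trans (solves-reduced j) (ι-eliminate r p b j)))

  obstruction-step : IntegralObstruction reducedMatrix reducedRhs → IntegralObstruction R b
  obstruction-step (w , w-annihilates , w·b≢0) =
    eliminateᵀ r p w , annihilates , λ w'·b≡0 → w·b≢0 (trans (sym (eliminate-adjoint r p w b)) w'·b≡0)
    where
    commutator : ∀ a s → a ℤ.* s ℤ.- s ℤ.* a ≡ 0ℤ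
    commutator = solve-∀
    annihilates : ∀ i → dotℤ (eliminateᵀ r p w) (column R i) ≡ 0ℤ
    annihilates zero    = trans (dotℤ-eliminateᵀ r p w r) (commutator (r p) (dotℤ w r))
    annihilates (suc i) = trans (eliminate-adjoint r p w (column R (suc i))) (w-annihilates i)

fredholm-alternative : ∀ {n} m (R : Matrix n m) (b : Fin n → ℤ) →
                       RationalSolution R b ⊎ IntegralObstruction R b
fredholm-alternative zero R b with zero-or-nonzero-entry b
... | inj₁ b≡0        = inj₁ ((λ ()) , λ j → cong ι (sym (b≡0 j)))
... | inj₂ (p , bₚ≢0) = inj₂ (basis p , (λ ()) , λ eₚ·b≡0 → bₚ≢0 (trans (sym (dotℤ-basis p b)) eₚ·b≡0))
fredholm-alternative (suc m) R b with zero-or-nonzero-entry (column R zero)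
... | inj₁ r≡0 =
  Sum.map solution-step obstruction-step (fredholm-alternative m (dropFirstColumn R) b)
  where open ZeroColumn R b r≡0
... | inj₂ (p , rₚ≢0) =
  Sum.map solution-step obstruction-step (fredholm-alternative m reducedMatrix reducedRhs)
  where open Pivot R b p rₚ≢0

_÷_ : ∀ {n} → Vecℤ n → (k : ℕ) .{{_ : NonZero k}} → Vecℚ n
(S ÷ k) i = ι (S i) ℚ.* (1ℤ ℚ./ k)

module _ {n} (M : Mat n) where

  ι-mulVec : ∀ v i → ι (mulVec M v i) ≡ mulVecℚ M (ι ∘ v) i
  ι-mulVec v i = trans (ι-sum (λ j → M i j ℤ.* v j)) (∑ℚ.∑-cong (λ j → ι-* (M i j) (v j)))

  mulVecℚ-*ʳ : ∀ Y c i → mulVecℚ M (λ j → Y j ℚ.* c) i ≡ mulVecℚ M Y i ℚ.* c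
  mulVecℚ-*ʳ Y c i = trans (∑ℚ.∑-cong (λ j → sym (ℚP.*-assoc (ι (M i j)) (Y j) c)))
                           (sym (∑ℚ.*-distribʳ-∑ c (λ j → ι (M i j) ℚ.* Y j)))

  pairM-mulVecℚ : ∀ X Y → pairM M X Y ≡ sumℚ (λ i → X i ℚ.* mulVecℚ M Y i)
  pairM-mulVecℚ X Y = ∑ℚ.∑-cong (λ i →
    trans (∑ℚ.∑-cong (λ j → ℚP.*-assoc (X i) (ι (M i j)) (Y j)))
          (sym (∑ℚ.*-distribˡ-∑ (X i) (λ j → ι (M i j) ℚ.* Y j))))

  pairM-rowMul : ∀ X Y → pairM M X Y ≡ sumℚ (λ j → rowMul X M j ℚ.* Y j)
  pairM-rowMul X Y = trans (∑ℚ.∑-comm (λ i j → X i ℚ.* ι (M i j) ℚ.* Y j))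
    (∑ℚ.∑-cong (λ j → sym (∑ℚ.*-distribʳ-∑ (Y j) (λ i → X i ℚ.* ι (M i j)))))

  pairM-exact : ∀ X Y T → (∀ i → mulVecℚ M Y i ≡ ι (T i)) → pairM M X Y ≡ evalHom X T
  pairM-exact X Y T MY≡T = trans (pairM-mulVecℚ X Y) (∑ℚ.∑-cong (λ i → cong (X i ℚ.*_) (MY≡T i)))

  ExactLift : Vecℚ n → Vecℤ n → Set
  ExactLift X T = ∀ j → rowMul X M j ≡ ι (T j)

  exact⇒homLift : ∀ X T → ExactLift X T → IsHomLift M X
  exact⇒homLift X T XM≡T j = T j , XM≡T j

  exact⇒rhoRep : ∀ X T → ExactLift X T → RhoRep M X T
  exact⇒rhoRep X T XM≡T Y _ = ≡⇒≡QZ (sym (trans (pairM-rowMul X Y)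
    (∑ℚ.∑-cong (λ j → trans (cong (ℚ._* Y j) (XM≡T j)) (ℚP.*-comm (ι (T j)) (Y j))))))

  module _ (M-sym : Symmetric M) where

    symmetric⇒exact : ∀ X T → (∀ i → mulVecℚ M X i ≡ ι (T i)) → ExactLift X T
    symmetric⇒exact X T MX≡T j = trans (∑ℚ.∑-cong (λ i →
      trans (ℚP.*-comm (X i) (ι (M i j))) (cong (λ m → ι m ℚ.* X i) (M-sym i j)))) (MX≡T j)

    dotℤ-column-symmetric : ∀ w i → dotℤ w (column M i) ≡ mulVec M w i
    dotℤ-column-symmetric w i =
      ∑ℤ.∑-cong (λ j → trans (ℤP.*-comm (w j) (M j i)) (cong (ℤ._* w j) (M-sym j i)))

  mulVecℚ-÷ : ∀ T k .{{_ : NonZero k}} S → IsBLData M T k S → ∀ i → mulVecℚ M (S ÷ k) i ≡ ι (T i)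
  mulVecℚ-÷ T k S MS≡kT i = begin
    mulVecℚ M (S ÷ k) i                    ≡⟨ mulVecℚ-*ʳ (ι ∘ S) κ i ⟩
    mulVecℚ M (ι ∘ S) i ℚ.* κ              ≡⟨ cong (ℚ._* κ) (sym (ι-mulVec S i)) ⟩
    ι (mulVec M S i) ℚ.* κ                 ≡⟨ cong (λ z → ι z ℚ.* κ) (MS≡kT i) ⟩
    ι (ℤ.+ k ℤ.* T i) ℚ.* κ                ≡⟨ cong (ℚ._* κ) (ι-* (ℤ.+ k) (T i)) ⟩
    ι (ℤ.+ k) ℚ.* ι (T i) ℚ.* κ            ≡⟨ regroup (ι (ℤ.+ k)) (ι (T i)) κ ⟩
    ι (T i) ℚ.* (ι (ℤ.+ k) ℚ.* κ)          ≡⟨ cong (ι (T i) ℚ.*_) (ι-*-1/ k) ⟩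
    ι (T i) ℚ.* 1ℚ                         ≡⟨ ℚP.*-identityʳ (ι (T i)) ⟩
    ι (T i)                                ∎
    where
    open ≡-Reasoning
    κ : ℚ
    κ = 1ℤ ℚ./ k
    regroup : ∀ a t c → a ℚ.* t ℚ.* c ≡ t ℚ.* (a ℚ.* c)
    regroup = solve 3 (λ a t c → a :* t :* c := t :* (a :* c)) refl

  blValue≡pairM-÷ : ∀ S S' k k' .{{_ : NonZero k}} .{{_ : NonZero k'}} →
                    blValue M S S' k k' ≡ pairM M (S ÷ k) (S' ÷ k')
  blValue≡pairM-÷ S S' k k' = sym (begin
    pairM M (S ÷ k) (S' ÷ k')
      ≡⟨ pairM-mulVecℚ (S ÷ k) (S' ÷ k') ⟩
    sumℚ (λ i → ι (S i) ℚ.* κ ℚ.* mulVecℚ M (S' ÷ k') i)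
      ≡⟨ ∑ℚ.∑-cong (λ i → cong (ι (S i) ℚ.* κ ℚ.*_) (mulVecℚ-*ʳ (ι ∘ S') κ' i)) ⟩
    sumℚ (λ i → ι (S i) ℚ.* κ ℚ.* (MS' i ℚ.* κ'))
      ≡⟨ ∑ℚ.∑-cong (λ i → regroup (ι (S i)) κ (MS' i) κ') ⟩
    sumℚ (λ i → ι (S i) ℚ.* MS' i ℚ.* (κ ℚ.* κ'))
      ≡⟨ sym (∑ℚ.*-distribʳ-∑ (κ ℚ.* κ') (λ i → ι (S i) ℚ.* MS' i)) ⟩
    sumℚ (λ i → ι (S i) ℚ.* MS' i) ℚ.* (κ ℚ.* κ')
      ≡⟨ cong (ℚ._* (κ ℚ.* κ')) (sym (trans (ι-dotℤ S (mulVec M S'))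
                                            (∑ℚ.∑-cong (λ i → cong (ι (S i) ℚ.*_) (ι-mulVec S' i))))) ⟩
    ι (dotℤ S (mulVec M S')) ℚ.* (κ ℚ.* κ')
      ≡⟨ sym (/-*-split (dotℤ S (mulVec M S')) k k') ⟩
    blValue M S S' k k' ∎)
    where
    open ≡-Reasoning
    κ κ' : ℚ
    κ  = 1ℤ ℚ./ k
    κ' = 1ℤ ℚ./ k'
    MS' : Vecℚ n
    MS' = mulVecℚ M (ι ∘ S')
    regroup : ∀ s c m c' → s ℚ.* c ℚ.* (m ℚ.* c') ≡ s ℚ.* m ℚ.* (c ℚ.* c')
    regroup = solve 4 (λ s c m c' → s :* c :* (m :* c') := s :* m :* (c :* c')) refl

ρ-surjective : ∀ {n} (M : Mat n) → Symmetric M → (T : Vecℤ n) → InKerPerp M T →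
               Σ (Vecℚ n) λ X → IsHomLift M X × RhoRep M X T
ρ-surjective {n} M M-sym T T⊥ker with fredholm-alternative n M T
... | inj₁ (X , MX≡T) = X , exact⇒homLift M X T XM≡T , exact⇒rhoRep M X T XM≡T
  where
  XM≡T : ExactLift M X T
  XM≡T = symmetric⇒exact M M-sym X T MX≡T
... | inj₂ (w , wM≡0 , w·T≢0) = ⊥-elim (w·T≢0 (trans (∑ℤ.∑-cong (λ j → ℤP.*-comm (w j) (T j)))
  (T⊥ker w (λ i → trans (sym (dotℤ-column-symmetric M M-sym w i)) (wM≡0 i)))))

ρ-pairing≡blPairing : ∀ {n} (M : Mat n) → Symmetric M →
  ∀ T T' X X' k k' .{{_ : NonZero k}} .{{_ : NonZero k'}} S S' →
  IsHomLift M X' → RhoRep M X T → RhoRep M X' T' → IsBLData M T k S → IsBLData M T' k' S' →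
  pairM M X X' ≡QZ blValue M S S' k k'
ρ-pairing≡blPairing M M-sym T T' X X' k k' S S' X'-lift ρX ρX' MS≡kT MS'≡k'T' = begin
  pairM M X X'              ≈⟨ ρX X' X'-lift ⟨
  evalHom X' T              ≡⟨ pairM-exact M X' (S ÷ k) T M[S÷k]≡T ⟨
  pairM M X' (S ÷ k)        ≈⟨ ρX' (S ÷ k) [S÷k]-lift ⟨
  evalHom (S ÷ k) T'        ≡⟨ pairM-exact M (S ÷ k) (S' ÷ k') T' (mulVecℚ-÷ M T' k' S' MS'≡k'T') ⟨
  pairM M (S ÷ k) (S' ÷ k') ≡⟨ blValue≡pairM-÷ M S S' k k' ⟨
  blValue M S S' k k'       ∎
  where
  open SetoidReasoning ℚ/ℤ-setoid
  M[S÷k]≡T : ∀ i → mulVecℚ M (S ÷ k) i ≡ ι (T i)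
  M[S÷k]≡T = mulVecℚ-÷ M T k S MS≡kT
  [S÷k]-lift : IsHomLift M (S ÷ k)
  [S÷k]-lift = exact⇒homLift M (S ÷ k) T (symmetric⇒exact M M-sym (S ÷ k) T M[S÷k]≡T)

lemma3p5 : (n : ℕ) (M : Mat n) → Symmetric M →
    ((T : Vecℤ n) → InKerPerp M T → Σ (Vecℚ n) (λ X → IsHomLift M X × RhoRep M X T))
    ×
    ((T T' : Vecℤ n) → InKerPerp M T → InKerPerp M T' →
     (X X' : Vecℚ n) → IsHomLift M X → IsHomLift M X' →
     RhoRep M X T → RhoRep M X' T' →
     (k k' : ℕ) .{{_ : NonZero k}} .{{_ : NonZero k'}} (S S' : Vecℤ n) →
     IsBLData M T k S → IsBLData M T' k' S' →
     pairM M X X' ≡QZ blValue M S S' k k')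
lemma3p5 n M M-sym = ρ-surjective M M-sym ,
  λ T T' _ _ X X' _ X'-lift ρX ρX' k k' S S' →
    ρ-pairing≡blPairing M M-sym T T' X X' k k' S S' X'-lift ρX ρX'
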